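{- In SC2Int, for every $n$: ($i_1$) if $(\Gamma, A \wedge B; \Delta) \vdash^{*} C$ is derivable with height at most $n$, then so is $(\Gamma, A, B; \Delta) \vdash^{*} C$; ($i_2$) if $(\Gamma; \Delta, A \wedge B) \vdash^{*} C$ is derivable with height at most $n$, then so are $(\Gamma; \Delta, A) \vdash^{*} C$ and $(\Gamma; \Delta, B) \vdash^{*} C$; ($ii_1$) if $(\Gamma, A \vee B; \Delta) \vdash^{*} C$ is derivable with height at most $n$, then so are $(\Gamma, A; \Delta) \vdash^{*} C$ and $(\Gamma, B; \Delta) \vdash^{*} C$; ($ii_2$) if $(\Gamma; \Delta, A \vee B) \vdash^{*} C$ is derivable with height at most $n$, then so is $(\Gamma; \Delta, A, B) \vdash^{*} C$; ($iii_1$) if $(\Gamma, A \rightarrow B; \Delta) \vdash^{*} C$ is derivable with height at most $n$, then so is $(\Gamma, B; \Delta) \vdash^{*} C$; ($iii_2$) if $(\Gamma; \Delta, A \rightarrow B) \vdash^{*} C$ is derivable with height at most $n$, then so is $(\Gamma, A; \Delta, B) \vdash^{*} C$; ($iv_1$) if $(\Gamma, A \mathbin{ -\!\!<} B; \Delta) \vdash^{*} C$ is derivable with height at most $n$, then so is $(\Gamma, A; \Delta, B) \vdash^{*} C$; ($iv_2$) if $(\Gamma; \Delta, A \mathbin{ -\!\!<} B) \vdash^{*} C$ is derivable with height at most $n$, then so is $(\Gamma; \Delta, A) \vdash^{*} C$.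
   Context: The language of the bi-intuitionistic logic 2Int is $A ::= p \mid \bot \mid \top \mid (A \wedge A) \mid (A \vee A) \mid (A \rightarrow A) \mid (A \mathbin{ -\!\!<} A)$, where $A \mathbin{ -\!\!<} B$ is co-implication (read "$B$ co-implies $A$"). Sequents have the form $(\Gamma; \Delta) \vdash^{*} C$ with $* \in \{+,-\}$, where $\Gamma$ (assumptions) and $\Delta$ (counterassumptions) are finite, possibly empty multisets. The calculus SC2Int has the following rules (for $* \in \{+,-\}$, $p$ atomic). Zero-premise rules: $(\Gamma, p; \Delta) \vdash^{+} p$; $(\Gamma; \Delta, p) \vdash^{ - } p$; $(\Gamma, \bot; \Delta) \vdash^{*} C$; $(\Gamma; \Delta, \top) \vdash^{*} C$; $(\Gamma; \Delta) \vdash^{ - } \bot$; $(\Gamma; \Delta) \vdash^{+} \top$. $\wedge R^{+}$: from $(\Gamma;\Delta)\vdash^{+}A$ and $(\Gamma;\Delta)\vdash^{+}B$ infer $(\Gamma;\Delta)\vdash^{+}A\wedge B$; $\wedge R^{ - }_{1,2}$: from $(\Gamma;\Delta)\vdash^{ - }A$ (resp. $B$) infer $(\Gamma;\Delta)\vdash^{ - }A\wedge B$; $\wedge L^{a}$: from $(\Gamma,A,B;\Delta)\vdash^{*}C$ infer $(\Gamma,A\wedge B;\Delta)\vdash^{*}C$; $\wedge L^{c}$: from $(\Gamma;\Delta,A)\vdash^{*}C$ and $(\Gamma;\Delta,B)\vdash^{*}C$ infer $(\Gamma;\Delta,A\wedge B)\vdash^{*}C$. $\vee R^{+}_{1,2}$: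 from $(\Gamma;\Delta)\vdash^{+}A$ (resp. $B$) infer $(\Gamma;\Delta)\vdash^{+}A\vee B$; $\vee R^{ - }$: from $(\Gamma;\Delta)\vdash^{ - }A$ and $(\Gamma;\Delta)\vdash^{ - }B$ infer $(\Gamma;\Delta)\vdash^{ - }A\vee B$; $\vee L^{a}$: from $(\Gamma,A;\Delta)\vdash^{*}C$ and $(\Gamma,B;\Delta)\vdash^{*}C$ infer $(\Gamma,A\vee B;\Delta)\vdash^{*}C$; $\vee L^{c}$: from $(\Gamma;\Delta,A,B)\vdash^{*}C$ infer $(\Gamma;\Delta,A\vee B)\vdash^{*}C$. $\rightarrow R^{+}$: from $(\Gamma,A;\Delta)\vdash^{+}B$ infer $(\Gamma;\Delta)\vdash^{+}A\rightarrow B$; $\rightarrow R^{ - }$: from $(\Gamma;\Delta)\vdash^{+}A$ and $(\Gamma;\Delta)\vdash^{ - }B$ infer $(\Gamma;\Delta)\vdash^{ - }A\rightarrow B$; $\rightarrow L^{a}$: from $(\Gamma,A\rightarrow B;\Delta)\vdash^{+}A$ and $(\Gamma,B;\Delta)\vdash^{*}C$ infer $(\Gamma,A\rightarrow B;\Delta)\vdash^{*}C$; $\rightarrow L^{c}$: from $(\Gamma,A;\Delta,B)\vdash^{*}C$ infer $(\Gamma;\Delta,A\rightarrow B)\vdash^{*}C$. Co-implication right $+$: from $(\Gamma;\Delta)\vdash^{+}A$ and $(\Gamma;\Delta)\vdash^{ - }B$ infer $(\Gamma;\Delta)\vdash^{+}A\mathbin{ -\!\!<}B$; right $-$: from $(\Gamma;\Delta,B)\vdash^{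 - }A$ infer $(\Gamma;\Delta)\vdash^{ - }A\mathbin{ -\!\!<}B$; left $a$: from $(\Gamma,A;\Delta,B)\vdash^{*}C$ infer $(\Gamma,A\mathbin{ -\!\!<}B;\Delta)\vdash^{*}C$; left $c$: from $(\Gamma;\Delta,A\mathbin{ -\!\!<}B)\vdash^{ - }B$ and $(\Gamma;\Delta,A)\vdash^{*}C$ infer $(\Gamma;\Delta,A\mathbin{ -\!\!<}B)\vdash^{*}C$. The height of a derivation is the greatest number of successive rule applications in it, zero-premise rules having height 0. -}

module Defs where

open import Data.Nat using (ℕ; zero; suc)
open import Data.List using (List; []; _∷_)
open import Data.List.Relation.Binary.Permutation.Propositional using (_↭_)

data Fm : Set where
  at   : ℕ → Fm
  ⊥'   : Fm
  ⊤'   : Fm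
  _∧'_ : Fm → Fm → Fm
  _∨'_ : Fm → Fm → Fm
  _⇒_  : Fm → Fm → Fm
  _⤙_  : Fm → Fm → Fm   -- A ⤙ B  is co-implication  A -< B

infixr 6 _∧'_
infixr 5 _∨'_
infixr 4 _⇒_ _⤙_

data Pol : Set where
  + - : Pol

-- Multisets of formulas are lists considered up to permutation (_↭_):
-- every rule takes its conclusion's context as an arbitrary list which is
-- required to be a permutation of  principal-formula ∷ rest.
Ctx : Set
Ctx = List Fm

-- Zero-premise rules are available at every bound n;
-- a rule with premises derived with height ≤ n yields height ≤ suc n.
data Der : ℕ → Ctx → Ctx → Pol → Fm → Set where
  ax+  : ∀ {n Γ Γ' Δ p} → Γ ↭ at p ∷ Γ' → Der n Γ Δ + (at p)
  ax-  : ∀ {n Γ Δ Δ' p} → Δ ↭ at p ∷ Δ' → Der n Γ Δ - (at p)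
  ⊥L   : ∀ {n Γ Γ' Δ s C} → Γ ↭ ⊥' ∷ Γ' → Der n Γ Δ s C
  ⊤L   : ∀ {n Γ Δ Δ' s C} → Δ ↭ ⊤' ∷ Δ' → Der n Γ Δ s C
  ⊥R-  : ∀ {n Γ Δ} → Der n Γ Δ - ⊥'
  ⊤R+  : ∀ {n Γ Δ} → Der n Γ Δ + ⊤'
  ∧R+  : ∀ {n Γ Δ A B} → Der n Γ Δ + A → Der n Γ Δ + B → Der (suc n) Γ Δ + (A ∧' B)
  ∧R-₁ : ∀ {n Γ Δ A B} → Der n Γ Δ - A → Der (suc n) Γ Δ - (A ∧' B)
  ∧R-₂ : ∀ {n Γ Δ A B} → Der n Γ Δ - B → Der (suc n) Γ Δ - (A ∧' B)
  ∧La  : ∀ {n Γ Γ' Δ s C A B} → Γ ↭ (A ∧' B) ∷ Γ' →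
         Der n (A ∷ B ∷ Γ') Δ s C → Der (suc n) Γ Δ s C
  ∧Lc  : ∀ {n Γ Δ Δ' s C A B} → Δ ↭ (A ∧' B) ∷ Δ' →
         Der n Γ (A ∷ Δ') s C → Der n Γ (B ∷ Δ') s C → Der (suc n) Γ Δ s C
  ∨R+₁ : ∀ {n Γ Δ A B} → Der n Γ Δ + A → Der (suc n) Γ Δ + (A ∨' B)
  ∨R+₂ : ∀ {n Γ Δ A B} → Der n Γ Δ + B → Der (suc n) Γ Δ + (A ∨' B)
  ∨R-  : ∀ {n Γ Δ A B} → Der n Γ Δ - A → Der n Γ Δ - B → Der (suc n) Γ Δ - (A ∨' B)
  ∨La  : ∀ {n Γ Γ' Δ s C A B} → Γ ↭ (A ∨' B) ∷ Γ' →
         Der n (A ∷ Γ') Δ s C → Der n (B ∷ Γ') Δ s C → Der (suc n) Γ Δ s C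
  ∨Lc  : ∀ {n Γ Δ Δ' s C A B} → Δ ↭ (A ∨' B) ∷ Δ' →
         Der n Γ (A ∷ B ∷ Δ') s C → Der (suc n) Γ Δ s C
  ⇒R+  : ∀ {n Γ Δ A B} → Der n (A ∷ Γ) Δ + B → Der (suc n) Γ Δ + (A ⇒ B)
  ⇒R-  : ∀ {n Γ Δ A B} → Der n Γ Δ + A → Der n Γ Δ - B → Der (suc n) Γ Δ - (A ⇒ B)
  ⇒La  : ∀ {n Γ Γ' Δ s C A B} → Γ ↭ (A ⇒ B) ∷ Γ' →
         Der n Γ Δ + A → Der n (B ∷ Γ') Δ s C → Der (suc n) Γ Δ s C
  ⇒Lc  : ∀ {n Γ Δ Δ' s C A B} → Δ ↭ (A ⇒ B) ∷ Δ' →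
         Der n (A ∷ Γ) (B ∷ Δ') s C → Der (suc n) Γ Δ s C
  ⤙R+  : ∀ {n Γ Δ A B} → Der n Γ Δ + A → Der n Γ Δ - B → Der (suc n) Γ Δ + (A ⤙ B)
  ⤙R-  : ∀ {n Γ Δ A B} → Der n Γ (B ∷ Δ) - A → Der (suc n) Γ Δ - (A ⤙ B)
  ⤙La  : ∀ {n Γ Γ' Δ s C A B} → Γ ↭ (A ⤙ B) ∷ Γ' →
         Der n (A ∷ Γ') (B ∷ Δ) s C → Der (suc n) Γ Δ s C
  ⤙Lc  : ∀ {n Γ Δ Δ' s C A B} → Δ ↭ (A ⤙ B) ∷ Δ' →
         Der n Γ Δ - B → Der n Γ (A ∷ Δ') s C → Der (suc n) Γ Δ s C

module Submission where

open import Defs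
open import Data.Nat using (ℕ; suc)
open import Data.List using ([]; _∷_; _++_)
open import Data.List.Membership.Propositional.Properties using (∈-∃++)
open import Data.List.Relation.Binary.Permutation.Propositional
open import Data.List.Relation.Binary.Permutation.Propositional.Properties
  using (∈-resp-↭; drop-∷; drop-mid; shift; shifts; ++⁺ˡ)
open import Data.List.Relation.Unary.Any using (here; there)
open import Data.Product using (_×_; _,_; ∃-syntax)
open import Data.Sum using (_⊎_; inj₁; inj₂)
open import Relation.Binary.PropositionalEquality using (_≡_; refl)

-- Height-preserving inversion is proved once for an arbitrary
-- formula F occurring in Γ (resp. Δ), by induction on the derivation. If F
-- is not principal in the last rule, invert the premises and reapply the
-- rule; if it is, the last rule is the unique rule introducing F on that
-- side, and the claim is read off its premises. For each connective of the
-- theorem that principal case is a premise, weakened by one in height.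

Der-resp-↭ : ∀ {n Γ Γ' Δ Δ' s C} → Γ ↭ Γ' → Δ ↭ Δ' → Der n Γ Δ s C → Der n Γ' Δ' s C
Der-resp-↭ g d (ax+ e)      = ax+ (↭-trans (↭-sym g) e)
Der-resp-↭ g d (ax- e)      = ax- (↭-trans (↭-sym d) e)
Der-resp-↭ g d (⊥L e)       = ⊥L (↭-trans (↭-sym g) e)
Der-resp-↭ g d (⊤L e)       = ⊤L (↭-trans (↭-sym d) e)
Der-resp-↭ g d ⊥R-          = ⊥R-
Der-resp-↭ g d ⊤R+          = ⊤R+
Der-resp-↭ g d (∧R+ x y)    = ∧R+ (Der-resp-↭ g d x) (Der-resp-↭ g d y)
Der-resp-↭ g d (∧R-₁ x)     = ∧R-₁ (Der-resp-↭ g d x)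
Der-resp-↭ g d (∧R-₂ x)     = ∧R-₂ (Der-resp-↭ g d x)
Der-resp-↭ g d (∧La e x)    = ∧La (↭-trans (↭-sym g) e) (Der-resp-↭ ↭-refl d x)
Der-resp-↭ g d (∧Lc e x y)  = ∧Lc (↭-trans (↭-sym d) e) (Der-resp-↭ g ↭-refl x) (Der-resp-↭ g ↭-refl y)
Der-resp-↭ g d (∨R+₁ x)     = ∨R+₁ (Der-resp-↭ g d x)
Der-resp-↭ g d (∨R+₂ x)     = ∨R+₂ (Der-resp-↭ g d x)
Der-resp-↭ g d (∨R- x y)    = ∨R- (Der-resp-↭ g d x) (Der-resp-↭ g d y)
Der-resp-↭ g d (∨La e x y)  = ∨La (↭-trans (↭-sym g) e) (Der-resp-↭ ↭-refl d x) (Der-resp-↭ ↭-refl d y)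
Der-resp-↭ g d (∨Lc e x)    = ∨Lc (↭-trans (↭-sym d) e) (Der-resp-↭ g ↭-refl x)
Der-resp-↭ g d (⇒R+ x)      = ⇒R+ (Der-resp-↭ (prep _ g) d x)
Der-resp-↭ g d (⇒R- x y)    = ⇒R- (Der-resp-↭ g d x) (Der-resp-↭ g d y)
Der-resp-↭ g d (⇒La e x y)  = ⇒La (↭-trans (↭-sym g) e) (Der-resp-↭ g d x) (Der-resp-↭ ↭-refl d y)
Der-resp-↭ g d (⇒Lc e x)    = ⇒Lc (↭-trans (↭-sym d) e) (Der-resp-↭ (prep _ g) ↭-refl x)
Der-resp-↭ g d (⤙R+ x y)    = ⤙R+ (Der-resp-↭ g d x) (Der-resp-↭ g d y)
Der-resp-↭ g d (⤙R- x)      = ⤙R- (Der-resp-↭ g (prep _ d) x)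
Der-resp-↭ g d (⤙La e x)    = ⤙La (↭-trans (↭-sym g) e) (Der-resp-↭ ↭-refl (prep _ d) x)
Der-resp-↭ g d (⤙Lc e x y)  = ⤙Lc (↭-trans (↭-sym d) e) (Der-resp-↭ g d x) (Der-resp-↭ g ↭-refl y)

Der-suc : ∀ {n Γ Δ s C} → Der n Γ Δ s C → Der (suc n) Γ Δ s C
Der-suc (ax+ e)     = ax+ e
Der-suc (ax- e)     = ax- e
Der-suc (⊥L e)      = ⊥L e
Der-suc (⊤L e)      = ⊤L e
Der-suc ⊥R-         = ⊥R-
Der-suc ⊤R+         = ⊤R+
Der-suc (∧R+ x y)   = ∧R+ (Der-suc x) (Der-suc y)
Der-suc (∧R-₁ x)    = ∧R-₁ (Der-suc x)
Der-suc (∧R-₂ x)    = ∧R-₂ (Der-suc x)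
Der-suc (∧La e x)   = ∧La e (Der-suc x)
Der-suc (∧Lc e x y) = ∧Lc e (Der-suc x) (Der-suc y)
Der-suc (∨R+₁ x)    = ∨R+₁ (Der-suc x)
Der-suc (∨R+₂ x)    = ∨R+₂ (Der-suc x)
Der-suc (∨R- x y)   = ∨R- (Der-suc x) (Der-suc y)
Der-suc (∨La e x y) = ∨La e (Der-suc x) (Der-suc y)
Der-suc (∨Lc e x)   = ∨Lc e (Der-suc x)
Der-suc (⇒R+ x)     = ⇒R+ (Der-suc x)
Der-suc (⇒R- x y)   = ⇒R- (Der-suc x) (Der-suc y)
Der-suc (⇒La e x y) = ⇒La e (Der-suc x) (Der-suc y)
Der-suc (⇒Lc e x)   = ⇒Lc e (Der-suc x)
Der-suc (⤙R+ x y)   = ⤙R+ (Der-suc x) (Der-suc y)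
Der-suc (⤙R- x)     = ⤙R- (Der-suc x)
Der-suc (⤙La e x)   = ⤙La e (Der-suc x)
Der-suc (⤙Lc e x y) = ⤙Lc e (Der-suc x) (Der-suc y)

∷-↭-∷-inv : ∀ {A : Set} {x y : A} {xs ys} → x ∷ xs ↭ y ∷ ys →
            (x ≡ y × ys ↭ xs) ⊎ ∃[ zs ] (xs ↭ y ∷ zs × ys ↭ x ∷ zs)
∷-↭-∷-inv p with ∈-resp-↭ p (here refl)
... | here refl = inj₁ (refl , ↭-sym (drop-∷ p))
... | there x∈ys with as , bs , refl ← ∈-∃++ x∈ys =
  inj₂ (as ++ bs , drop-mid [] (_ ∷ as) p , shift _ as bs)

↭-∷-under : ∀ {A : Set} ws {x : A} {xs ys} → xs ↭ x ∷ ys → ws ++ xs ↭ x ∷ ws ++ ys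
↭-∷-under ws {x} p = ↭-trans (++⁺ˡ ws p) (shift x ws _)

data AssumptionPrincipal : ℕ → Fm → Ctx → Ctx → Pol → Fm → Set where
  ax+ : ∀ {n Γ Δ p} → AssumptionPrincipal n (at p) Γ Δ + (at p)
  ⊥L  : ∀ {n Γ Δ s C} → AssumptionPrincipal n ⊥' Γ Δ s C
  ∧La : ∀ {n Γ Δ s C A B} → Der n (A ∷ B ∷ Γ) Δ s C →
        AssumptionPrincipal (suc n) (A ∧' B) Γ Δ s C
  ∨La : ∀ {n Γ Δ s C A B} → Der n (A ∷ Γ) Δ s C → Der n (B ∷ Γ) Δ s C →
        AssumptionPrincipal (suc n) (A ∨' B) Γ Δ s C
  ⇒La : ∀ {n Γ Δ s C A B} → Der n ((A ⇒ B) ∷ Γ) Δ + A → Der n (B ∷ Γ) Δ s C →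
        AssumptionPrincipal (suc n) (A ⇒ B) Γ Δ s C
  ⤙La : ∀ {n Γ Δ s C A B} → Der n (A ∷ Γ) (B ∷ Δ) s C →
        AssumptionPrincipal (suc n) (A ⤙ B) Γ Δ s C

data CounterassumptionPrincipal : ℕ → Fm → Ctx → Ctx → Pol → Fm → Set where
  ax- : ∀ {n Γ Δ p} → CounterassumptionPrincipal n (at p) Γ Δ - (at p)
  ⊤L  : ∀ {n Γ Δ s C} → CounterassumptionPrincipal n ⊤' Γ Δ s C
  ∧Lc : ∀ {n Γ Δ s C A B} → Der n Γ (A ∷ Δ) s C → Der n Γ (B ∷ Δ) s C →
        CounterassumptionPrincipal (suc n) (A ∧' B) Γ Δ s C
  ∨Lc : ∀ {n Γ Δ s C A B} → Der n Γ (A ∷ B ∷ Δ) s C →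
        CounterassumptionPrincipal (suc n) (A ∨' B) Γ Δ s C
  ⇒Lc : ∀ {n Γ Δ s C A B} → Der n (A ∷ Γ) (B ∷ Δ) s C →
        CounterassumptionPrincipal (suc n) (A ⇒ B) Γ Δ s C
  ⤙Lc : ∀ {n Γ Δ s C A B} → Der n Γ ((A ⤙ B) ∷ Δ) - B → Der n Γ (A ∷ Δ) s C →
        CounterassumptionPrincipal (suc n) (A ⤙ B) Γ Δ s C

module AssumptionInversion {F : Fm} {G D : Ctx}
  (principal : ∀ {n Γ Δ s C} → AssumptionPrincipal n F Γ Δ s C → Der n (G ++ Γ) (D ++ Δ) s C)
  where

  mutual
    invert : ∀ {n Γ₀ Γ Δ s C} → Γ₀ ↭ F ∷ Γ → Der n Γ₀ Δ s C → Der n (G ++ Γ) (D ++ Δ) s C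
    invert q (ax+ e) with ∷-↭-∷-inv (↭-trans (↭-sym q) e)
    ... | inj₁ (refl , _)     = principal ax+
    ... | inj₂ (_ , r , _)    = ax+ (↭-∷-under G r)
    invert q (ax- e)          = ax- (↭-∷-under D e)
    invert q (⊥L e) with ∷-↭-∷-inv (↭-trans (↭-sym q) e)
    ... | inj₁ (refl , _)     = principal ⊥L
    ... | inj₂ (_ , r , _)    = ⊥L (↭-∷-under G r)
    invert q (⊤L e)           = ⊤L (↭-∷-under D e)
    invert q ⊥R-              = ⊥R-
    invert q ⊤R+              = ⊤R+
    invert q (∧R+ x y)        = ∧R+ (invert q x) (invert q y)
    invert q (∧R-₁ x)         = ∧R-₁ (invert q x)
    invert q (∧R-₂ x)         = ∧R-₂ (invert q x)
    invert q (∧La e x) with ∷-↭-∷-inv (↭-trans (↭-sym q) e)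
    ... | inj₁ (refl , r)     = principal (∧La (Der-resp-↭ (prep _ (prep _ r)) ↭-refl x))
    ... | inj₂ (_ , r , r')   = ∧La (↭-∷-under G r) (invert-under (_ ∷ _ ∷ []) [] r' x)
    invert q (∧Lc e x y)      = ∧Lc (↭-∷-under D e) (invert-under [] (_ ∷ []) q x)
                                                   (invert-under [] (_ ∷ []) q y)
    invert q (∨R+₁ x)         = ∨R+₁ (invert q x)
    invert q (∨R+₂ x)         = ∨R+₂ (invert q x)
    invert q (∨R- x y)        = ∨R- (invert q x) (invert q y)
    invert q (∨La e x y) with ∷-↭-∷-inv (↭-trans (↭-sym q) e)
    ... | inj₁ (refl , r)     = principal (∨La (Der-resp-↭ (prep _ r) ↭-refl x)
                                               (Der-resp-↭ (prep _ r) ↭-refl y))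
    ... | inj₂ (_ , r , r')   = ∨La (↭-∷-under G r) (invert-under (_ ∷ []) [] r' x)
                                                    (invert-under (_ ∷ []) [] r' y)
    invert q (∨Lc e x)        = ∨Lc (↭-∷-under D e) (invert-under [] (_ ∷ _ ∷ []) q x)
    invert q (⇒R+ x)          = ⇒R+ (invert-under (_ ∷ []) [] q x)
    invert q (⇒R- x y)        = ⇒R- (invert q x) (invert q y)
    invert q (⇒La e x y) with ∷-↭-∷-inv (↭-trans (↭-sym q) e)
    ... | inj₁ (refl , r)     = principal (⇒La (Der-resp-↭ q ↭-refl x)
                                               (Der-resp-↭ (prep _ r) ↭-refl y))
    ... | inj₂ (_ , r , r')   = ⇒La (↭-∷-under G r) (invert q x) (invert-under (_ ∷ []) [] r' y)
    invert q (⇒Lc e x)        = ⇒Lc (↭-∷-under D e) (invert-under (_ ∷ []) (_ ∷ []) q x)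
    invert q (⤙R+ x y)        = ⤙R+ (invert q x) (invert q y)
    invert q (⤙R- x)          = ⤙R- (invert-under [] (_ ∷ []) q x)
    invert q (⤙La e x) with ∷-↭-∷-inv (↭-trans (↭-sym q) e)
    ... | inj₁ (refl , r)     = principal (⤙La (Der-resp-↭ (prep _ r) ↭-refl x))
    ... | inj₂ (_ , r , r')   = ⤙La (↭-∷-under G r) (invert-under (_ ∷ []) (_ ∷ []) r' x)
    invert q (⤙Lc e x y)      = ⤙Lc (↭-∷-under D e) (invert q x) (invert-under [] (_ ∷ []) q y)

    invert-under : ∀ xs ys {n Γ₀ Γ Δ s C} → Γ₀ ↭ F ∷ Γ →
                   Der n (xs ++ Γ₀) (ys ++ Δ) s C → Der n (xs ++ G ++ Γ) (ys ++ D ++ Δ) s C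
    invert-under xs ys q d = Der-resp-↭ (shifts G xs) (shifts D ys) (invert (↭-∷-under xs q) d)

module CounterassumptionInversion {F : Fm} {G D : Ctx}
  (principal : ∀ {n Γ Δ s C} → CounterassumptionPrincipal n F Γ Δ s C → Der n (G ++ Γ) (D ++ Δ) s C)
  where

  mutual
    invert : ∀ {n Γ Δ₀ Δ s C} → Δ₀ ↭ F ∷ Δ → Der n Γ Δ₀ s C → Der n (G ++ Γ) (D ++ Δ) s C
    invert q (ax+ e)          = ax+ (↭-∷-under G e)
    invert q (ax- e) with ∷-↭-∷-inv (↭-trans (↭-sym q) e)
    ... | inj₁ (refl , _)     = principal ax-
    ... | inj₂ (_ , r , _)    = ax- (↭-∷-under D r)
    invert q (⊥L e)           = ⊥L (↭-∷-under G e)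
    invert q (⊤L e) with ∷-↭-∷-inv (↭-trans (↭-sym q) e)
    ... | inj₁ (refl , _)     = principal ⊤L
    ... | inj₂ (_ , r , _)    = ⊤L (↭-∷-under D r)
    invert q ⊥R-              = ⊥R-
    invert q ⊤R+              = ⊤R+
    invert q (∧R+ x y)        = ∧R+ (invert q x) (invert q y)
    invert q (∧R-₁ x)         = ∧R-₁ (invert q x)
    invert q (∧R-₂ x)         = ∧R-₂ (invert q x)
    invert q (∧La e x)        = ∧La (↭-∷-under G e) (invert-under (_ ∷ _ ∷ []) [] q x)
    invert q (∧Lc e x y) with ∷-↭-∷-inv (↭-trans (↭-sym q) e)
    ... | inj₁ (refl , r)     = principal (∧Lc (Der-resp-↭ ↭-refl (prep _ r) x)
                                               (Der-resp-↭ ↭-refl (prep _ r) y))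
    ... | inj₂ (_ , r , r')   = ∧Lc (↭-∷-under D r) (invert-under [] (_ ∷ []) r' x)
                                                    (invert-under [] (_ ∷ []) r' y)
    invert q (∨R+₁ x)         = ∨R+₁ (invert q x)
    invert q (∨R+₂ x)         = ∨R+₂ (invert q x)
    invert q (∨R- x y)        = ∨R- (invert q x) (invert q y)
    invert q (∨La e x y)      = ∨La (↭-∷-under G e) (invert-under (_ ∷ []) [] q x)
                                                    (invert-under (_ ∷ []) [] q y)
    invert q (∨Lc e x) with ∷-↭-∷-inv (↭-trans (↭-sym q) e)
    ... | inj₁ (refl , r)     = principal (∨Lc (Der-resp-↭ ↭-refl (prep _ (prep _ r)) x))
    ... | inj₂ (_ , r , r')   = ∨Lc (↭-∷-under D r) (invert-under [] (_ ∷ _ ∷ []) r' x)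
    invert q (⇒R+ x)          = ⇒R+ (invert-under (_ ∷ []) [] q x)
    invert q (⇒R- x y)        = ⇒R- (invert q x) (invert q y)
    invert q (⇒La e x y)      = ⇒La (↭-∷-under G e) (invert q x) (invert-under (_ ∷ []) [] q y)
    invert q (⇒Lc e x) with ∷-↭-∷-inv (↭-trans (↭-sym q) e)
    ... | inj₁ (refl , r)     = principal (⇒Lc (Der-resp-↭ ↭-refl (prep _ r) x))
    ... | inj₂ (_ , r , r')   = ⇒Lc (↭-∷-under D r) (invert-under (_ ∷ []) (_ ∷ []) r' x)
    invert q (⤙R+ x y)        = ⤙R+ (invert q x) (invert q y)
    invert q (⤙R- x)          = ⤙R- (invert-under [] (_ ∷ []) q x)
    invert q (⤙La e x)        = ⤙La (↭-∷-under G e) (invert-under (_ ∷ []) (_ ∷ []) q x)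
    invert q (⤙Lc e x y) with ∷-↭-∷-inv (↭-trans (↭-sym q) e)
    ... | inj₁ (refl , r)     = principal (⤙Lc (Der-resp-↭ ↭-refl q x)
                                               (Der-resp-↭ ↭-refl (prep _ r) y))
    ... | inj₂ (_ , r , r')   = ⤙Lc (↭-∷-under D r) (invert q x) (invert-under [] (_ ∷ []) r' y)

    invert-under : ∀ xs ys {n Γ Δ₀ Δ s C} → Δ₀ ↭ F ∷ Δ →
                   Der n (xs ++ Γ) (ys ++ Δ₀) s C → Der n (xs ++ G ++ Γ) (ys ++ D ++ Δ) s C
    invert-under xs ys q d = Der-resp-↭ (shifts G xs) (shifts D ys) (invert (↭-∷-under ys q) d)

assumption-inversion :
  ∀ {F G D} → (∀ {n Γ Δ s C} → AssumptionPrincipal n F Γ Δ s C → Der n (G ++ Γ) (D ++ Δ) s C) →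
  ∀ {n Γ Δ s C} → Der n (F ∷ Γ) Δ s C → Der n (G ++ Γ) (D ++ Δ) s C
assumption-inversion principal = AssumptionInversion.invert principal ↭-refl

counterassumption-inversion :
  ∀ {F G D} → (∀ {n Γ Δ s C} → CounterassumptionPrincipal n F Γ Δ s C → Der n (G ++ Γ) (D ++ Δ) s C) →
  ∀ {n Γ Δ s C} → Der n Γ (F ∷ Δ) s C → Der n (G ++ Γ) (D ++ Δ) s C
counterassumption-inversion principal = CounterassumptionInversion.invert principal ↭-refl

lemma3p3p1 : ∀ (n : ℕ) {Γ Δ : Ctx} {s : Pol} {A B C : Fm} →
    -- (i1)
    (Der n ((A ∧' B) ∷ Γ) Δ s C → Der n (A ∷ B ∷ Γ) Δ s C)
    -- (i2)
    × (Der n Γ ((A ∧' B) ∷ Δ) s C → Der n Γ (A ∷ Δ) s C × Der n Γ (B ∷ Δ) s C)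
    -- (ii1)
    × (Der n ((A ∨' B) ∷ Γ) Δ s C → Der n (A ∷ Γ) Δ s C × Der n (B ∷ Γ) Δ s C)
    -- (ii2)
    × (Der n Γ ((A ∨' B) ∷ Δ) s C → Der n Γ (A ∷ B ∷ Δ) s C)
    -- (iii1)
    × (Der n ((A ⇒ B) ∷ Γ) Δ s C → Der n (B ∷ Γ) Δ s C)
    -- (iii2)
    × (Der n Γ ((A ⇒ B) ∷ Δ) s C → Der n (A ∷ Γ) (B ∷ Δ) s C)
    -- (iv1)
    × (Der n ((A ⤙ B) ∷ Γ) Δ s C → Der n (A ∷ Γ) (B ∷ Δ) s C)
    -- (iv2)
    × (Der n Γ ((A ⤙ B) ∷ Δ) s C → Der n Γ (A ∷ Δ) s C)
lemma3p3p1 n =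
    assumption-inversion (λ { (∧La d) → Der-suc d })
  , (λ d → counterassumption-inversion (λ { (∧Lc d₁ _) → Der-suc d₁ }) d
         , counterassumption-inversion (λ { (∧Lc _ d₂) → Der-suc d₂ }) d)
  , (λ d → assumption-inversion (λ { (∨La d₁ _) → Der-suc d₁ }) d
         , assumption-inversion (λ { (∨La _ d₂) → Der-suc d₂ }) d)
  , counterassumption-inversion (λ { (∨Lc d) → Der-suc d })
  , assumption-inversion (λ { (⇒La _ d₂) → Der-suc d₂ })
  , counterassumption-inversion (λ { (⇒Lc d) → Der-suc d })
  , assumption-inversion (λ { (⤙La d) → Der-suc d })
  , counterassumption-inversion (λ { (⤙Lc _ d₂) → Der-suc d₂ })
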